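{- Let $k\ge 1$, let $\mathbf{r}=(r_0,\ldots,r_{k-1})$ be a $k$-tuple of positive integers and $h$ a positive integer. Let $X=(x_0,\ldots,x_{k-1})\in R(\mathbf{r},h)$ and $Y=(y_0,\ldots,y_{k-1})\in R(\mathbf{r},h)$ with $X\ne Y$. If $$\sum_{j=i}^{k-1}x_j\le\sum_{j=i}^{k-1}y_j\quad\text{for } i=1,2,\ldots,k-1,$$ then there exists an $(\mathbf{r},h)$-path from $X$ to $Y$, i.e. an $(\mathbf{r},h)$-path $X_1\rightarrow X_2\rightarrow\cdots\rightarrow X_t$ with $X_1=X$ and $X_t=Y$.
   Context: $\mathbb{N}$ denotes the nonnegative integers. $R(\mathbf{r},h)$ is the set of all $(x_0,\ldots,x_{k-1})\in\mathbb{N}^k$ with $\sum_{j=0}^{k-1}x_j=h$ and $0\le x_i\le r_i$ for all $i$. For $U=(u_0,\ldots,u_{k-1}),W=(w_0,\ldots,w_{k-1})\in\mathbb{N}^k$, $U\rightarrow W$ is called a step if there is an index $j$ with $0\le j\le k-2$ such that $w_j=u_j-1$, $w_{j+1}=u_{j+1}+1$, and $w_i=u_i$ for all $i\ne j,j+1$. A sequence $X_1\rightarrow X_2\rightarrow\cdots\rightarrow X_t$ is an $(\mathbf{r},h)$-path of length $t$ if every $X_i\in R(\mathbf{r},h)$ and each $X_i\rightarrow X_{i+1}$ ($1\le i\le t-1$) is a step. -}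

module Defs where

open import Data.Nat using (ℕ; zero; suc; _+_; _≤_; _<_)
open import Data.Fin using (Fin; toℕ)
open import Data.Vec using (Vec; []; _∷_; lookup)
open import Data.List using (List; []; _∷_)
open import Data.Product using (Σ; _×_; ∃-syntax)
open import Relation.Binary.PropositionalEquality using (_≡_; _≢_)

vsum : ∀ {k} → Vec ℕ k → ℕ
vsum [] = 0
vsum (x ∷ xs) = x + vsum xs

tailSum : ∀ {k} → ℕ → Vec ℕ k → ℕ
tailSum zero v = vsum v
tailSum (suc i) [] = 0
tailSum (suc i) (x ∷ xs) = tailSum i xs

InR : ∀ {k} → Vec ℕ k → ℕ → Vec ℕ k → Set
InR {k} r h x = vsum x ≡ h × ((i : Fin k) → lookup x i ≤ lookup r i)

-- U → W is a step: there is j with j+1 ≤ k-1 such that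
-- w_j = u_j - 1, w_{j+1} = u_{j+1} + 1, other coordinates equal.
-- (w_j = u_j - 1 in ℕ is stated as u_j = w_j + 1, i.e. genuine subtraction.)
Step : ∀ {k} → Vec ℕ k → Vec ℕ k → Set
Step {k} U W =
  ∃[ j ] ∃[ j′ ] (toℕ j′ ≡ suc (toℕ j)
    × lookup W j + 1 ≡ lookup U j
    × lookup W j′ ≡ lookup U j′ + 1
    × ((i : Fin k) → i ≢ j → i ≢ j′ → lookup W i ≡ lookup U i))

data PathFrom {k} (r : Vec ℕ k) (h : ℕ) : Vec ℕ k → Vec ℕ k → List (Vec ℕ k) → Set where
  single : ∀ {X} → InR r h X → PathFrom r h X X (X ∷ [])
  cons   : ∀ {X Z Y L} → InR r h X → Step X Z → PathFrom r h Z Y L →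
           PathFrom r h X Y (X ∷ L)

HasPath : ∀ {k} → Vec ℕ k → ℕ → Vec ℕ k → Vec ℕ k → Set
HasPath r h X Y = ∃[ L ] PathFrom r h X Y L

-- Walk from X towards Y, keeping the walk inside R(r,h) and dominated by Y in
-- every tail sum.  If X ≢ Y, some tail sum of X is strictly below that of Y.
-- Look at the first such tail, starting at position m: the entry x_{m-1} just
-- before it exceeds y_{m-1} and hence is positive.  Pushing a unit from
-- position m-1 to m fails only if x_m is full; but then x_m = r_m ≥ max(1, y_m),
-- so x_m is positive and the tail starting at m+1 is again deficient, and we
-- push from m instead.  The last tail is empty, so some push succeeds.  Each
-- step raises exactly one tail sum of X by one, so the total deficit
-- Σ_{i ≥ 1} (tailSum i Y ∸ tailSum i X) strictly decreases.

module Submission where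

open import Defs
open import Data.Nat using (ℕ; zero; suc; _+_; _∸_; _≤_; _<_; z≤n; s≤s; _<?_; _≟_)
open import Data.Nat.Properties
open import Data.Nat.Induction using (<-wellFounded)
open import Data.Fin using (Fin; zero; suc)
open import Data.Vec using (Vec; []; _∷_; lookup)
open import Data.Vec.Properties using (≡-dec)
open import Data.Vec.Relation.Binary.Pointwise.Inductive as Pointwise using (Pointwise; _∷_)
open import Data.Vec.Relation.Binary.Pointwise.Extensional using (ext; extensional⇒inductive)
open import Data.Vec.Relation.Unary.All using (All; _∷_)
open import Data.Vec.Relation.Unary.All.Properties using (lookup⁻)
open import Data.List using (_∷_; [])
open import Data.Product using (_×_; _,_)
open import Data.Sum using (inj₁; inj₂)
open import Data.Unit using (⊤; tt)
open import Data.Empty using (⊥-elim)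
open import Function using (_∘′_)
open import Induction.WellFounded using (Acc; acc)
open import Relation.Nullary using (yes; no)
open import Relation.Binary.PropositionalEquality

TailDominated : ∀ {n} → Vec ℕ n → Vec ℕ n → Set
TailDominated [] [] = ⊤
TailDominated (x ∷ xs) (y ∷ ys) = vsum xs ≤ vsum ys × TailDominated xs ys

deficit : ∀ {n} → Vec ℕ n → Vec ℕ n → ℕ
deficit [] [] = 0
deficit (x ∷ xs) (y ∷ ys) = (vsum ys ∸ vsum xs) + deficit xs ys

tailSum≤⇒TailDominated : ∀ {n} (X Y : Vec ℕ n) →
  ((i : ℕ) → 1 ≤ i → i < n → tailSum i X ≤ tailSum i Y) → TailDominated X Y
tailSum≤⇒TailDominated [] [] _ = tt
tailSum≤⇒TailDominated (x ∷ []) (y ∷ []) _ = z≤n , tt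
tailSum≤⇒TailDominated (x ∷ x′ ∷ X) (y ∷ y′ ∷ Y) tail≤ =
  tail≤ 1 (s≤s z≤n) (s≤s (s≤s z≤n)) ,
  tailSum≤⇒TailDominated (x′ ∷ X) (y′ ∷ Y) (λ i _ i<n → tail≤ (suc i) (s≤s z≤n) (s≤s i<n))

Step-∷ : ∀ {n} a {U W : Vec ℕ n} → Step U W → Step (a ∷ U) (a ∷ W)
Step-∷ {n} a {U} {W} (j , j′ , j′≡1+j , W≡U-1 , W≡U+1 , others) =
  suc j , suc j′ , cong suc j′≡1+j , W≡U-1 , W≡U+1 , others′
  where
  others′ : (i : Fin (suc n)) → i ≢ suc j → i ≢ suc j′ → lookup (a ∷ W) i ≡ lookup (a ∷ U) i
  others′ zero _ _ = refl
  others′ (suc i) i≢j i≢j′ = others i (i≢j ∘′ cong suc) (i≢j′ ∘′ cong suc)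

Step-head : ∀ {n} a b (U : Vec ℕ n) → Step (suc a ∷ b ∷ U) (a ∷ suc b ∷ U)
Step-head {n} a b U = zero , suc zero , refl , +-comm a 1 , +-comm 1 b , others
  where
  others : (i : Fin (suc (suc n))) → i ≢ zero → i ≢ suc zero →
           lookup (a ∷ suc b ∷ U) i ≡ lookup (suc a ∷ b ∷ U) i
  others zero i≢0 _ = ⊥-elim (i≢0 refl)
  others (suc zero) _ i≢1 = ⊥-elim (i≢1 refl)
  others (suc (suc i)) _ _ = refl

record StepTowards {n} (r Y X : Vec ℕ n) : Set where
  constructor stepTo
  field
    next      : Vec ℕ n
    step      : Step X next
    bounded   : Pointwise _≤_ next r
    vsum-next : vsum next ≡ vsum X
    dominated : TailDominated next Y
    closer    : deficit next Y < deficit X Y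

StepTowards-∷ : ∀ {n} {r Y X : Vec ℕ n} {r₀ y x} → x ≤ r₀ → vsum X ≤ vsum Y →
  StepTowards r Y X → StepTowards (r₀ ∷ r) (y ∷ Y) (x ∷ X)
StepTowards-∷ {Y = Y} {X} {x = x} x≤r₀ X≤Y (stepTo Z step bZ sZ dZ closer) =
  stepTo (x ∷ Z) (Step-∷ x step) (x≤r₀ ∷ bZ) (cong (x +_) sZ)
    (subst (_≤ vsum Y) (sym sZ) X≤Y , dZ)
    (subst (λ s → (vsum Y ∸ s) + deficit Z Y < (vsum Y ∸ vsum X) + deficit X Y)
      (sym sZ) (+-monoʳ-< (vsum Y ∸ vsum X) closer))

StepTowards-head : ∀ {n} {r X Y : Vec ℕ n} {r₀ r₁ y c} a b → suc a ≤ r₀ → suc b ≤ r₁ →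
  Pointwise _≤_ X r → b + vsum X < c + vsum Y → TailDominated (b ∷ X) (c ∷ Y) →
  StepTowards (r₀ ∷ r₁ ∷ r) (y ∷ c ∷ Y) (suc a ∷ b ∷ X)
StepTowards-head {X = X} {Y} {c = c} a b a<r₀ b<r₁ bX deficient dom =
  stepTo (a ∷ suc b ∷ X) (Step-head a b X) (<⇒≤ a<r₀ ∷ b<r₁ ∷ bX)
    (+-suc a (b + vsum X)) (deficient , dom)
    (+-monoˡ-< _ (∸-monoʳ-< (n<1+n (b + vsum X)) deficient))

tail-deficient : ∀ {b c s t} → c ≤ b → b + s < c + t → s < t
tail-deficient c≤b deficient = ≰⇒> (λ t≤s → <⇒≱ deficient (+-mono-≤ c≤b t≤s))

push-right : ∀ {n} {r X Y : Vec ℕ n} {r₀ y} a → suc a ≤ r₀ → All (1 ≤_) r →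
  Pointwise _≤_ X r → Pointwise _≤_ Y r → vsum X < vsum Y → TailDominated X Y →
  StepTowards (r₀ ∷ r) (y ∷ Y) (suc a ∷ X)
push-right {X = []} {[]} _ _ _ _ _ () _
push-right {X = zero ∷ _} {_ ∷ _} a a<r₀ (1≤r₁ ∷ _) (_ ∷ bX) _ deficient dom =
  StepTowards-head a zero a<r₀ 1≤r₁ bX deficient dom
push-right {r = r₁ ∷ _} {suc b ∷ X} {c ∷ Y} a a<r₀ (_ ∷ pos) (b<r₁ ∷ bX) (c≤r₁ ∷ bY)
  deficient dom@(X≤Y , domXY) with suc b <? r₁
... | yes 1+b<r₁ = StepTowards-head a (suc b) a<r₀ 1+b<r₁ bX deficient dom
... | no  1+b≮r₁ = StepTowards-∷ a<r₀ (<⇒≤ deficient)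
      (push-right b b<r₁ pos bX bY (tail-deficient (≤-trans c≤r₁ (≮⇒≥ 1+b≮r₁)) deficient) domXY)

StepTowards-surplus : ∀ {n} {r X Y : Vec ℕ n} {r₀ y} x → x ≤ r₀ → All (1 ≤_) r →
  Pointwise _≤_ X r → Pointwise _≤_ Y r → x + vsum X ≡ y + vsum Y → vsum X < vsum Y →
  TailDominated X Y → StepTowards (r₀ ∷ r) (y ∷ Y) (x ∷ X)
StepTowards-surplus {Y = Y} {y = y} zero _ _ _ _ sum deficient _ =
  ⊥-elim (<⇒≱ deficient (subst (vsum Y ≤_) (sym sum) (m≤n+m (vsum Y) y)))
StepTowards-surplus (suc a) x≤r₀ pos bX bY _ deficient dom = push-right a x≤r₀ pos bX bY deficient dom

stepTowards : ∀ {n} {r X Y : Vec ℕ n} → All (1 ≤_) r → Pointwise _≤_ X r → Pointwise _≤_ Y r →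
  vsum X ≡ vsum Y → TailDominated X Y → X ≢ Y → StepTowards r Y X
stepTowards {X = []} {[]} _ _ _ _ _ X≢Y = ⊥-elim (X≢Y refl)
stepTowards {X = x ∷ X} {y ∷ Y} (_ ∷ pos) (x≤r₀ ∷ bX) (_ ∷ bY) sum (X≤Y , dom) xX≢yY
  with m≤n⇒m<n∨m≡n X≤Y
... | inj₁ deficient = StepTowards-surplus x x≤r₀ pos bX bY sum deficient dom
... | inj₂ sX≡sY = StepTowards-∷ x≤r₀ X≤Y
      (stepTowards pos bX bY sX≡sY dom (λ X≡Y → xX≢yY (cong₂ _∷_ x≡y X≡Y)))
  where
  x≡y : x ≡ y
  x≡y = +-cancelʳ-≡ (vsum Y) x y (trans (cong (x +_) (sym sX≡sY)) sum)

module _ {n} {r Y : Vec ℕ n} {h} (pos : All (1 ≤_) r) (bY : Pointwise _≤_ Y r) (sY : vsum Y ≡ h) where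

  pathTowards : ∀ X → Acc _<_ (deficit X Y) → vsum X ≡ h → Pointwise _≤_ X r →
    TailDominated X Y → HasPath r h X Y
  pathTowards X (acc rec) sX bX dom with ≡-dec _≟_ X Y
  ... | yes refl = X ∷ [] , single (sX , Pointwise.lookup bX)
  ... | no X≢Y with stepTowards pos bX bY (trans sX (sym sY)) dom X≢Y
  ...   | stepTo Z step bZ sZ dZ closer with pathTowards Z (rec closer) (trans sZ sX) bZ dZ
  ...     | L , path = X ∷ L , cons (sX , Pointwise.lookup bX) step path

lemma2 : (k : ℕ) → 1 ≤ k → (r : Vec ℕ k) → ((i : Fin k) → 1 ≤ lookup r i) →
    (h : ℕ) → 1 ≤ h → (X Y : Vec ℕ k) → InR r h X → InR r h Y → X ≢ Y →
    ((i : ℕ) → 1 ≤ i → i < k → tailSum i X ≤ tailSum i Y) →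
    HasPath r h X Y
lemma2 k _ r pos h _ X Y (sX , bX) (sY , bY) _ tail≤ =
  pathTowards (lookup⁻ pos) (bounded bY) sY X (<-wellFounded (deficit X Y)) sX (bounded bX)
    (tailSum≤⇒TailDominated X Y tail≤)
  where
  bounded : ∀ {Z} → ((i : Fin k) → lookup Z i ≤ lookup r i) → Pointwise _≤_ Z r
  bounded Z≤r = extensional⇒inductive (ext Z≤r)
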